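{- In the hyperdoctrine of mass problems $\mathcal{P}_{\mathcal{M}}$, for any object $X$ of the base category, the equality element $=_X\in\mathcal{P}_{\mathcal{M}}(X\times X)$ is given (identifying $X\times X$ with $X$ via the fixed pairing $\langle n,m\rangle$) by $(=_X)_{\langle n,m\rangle}=\omega^\omega$ if $n=m$ and $(=_X)_{\langle n,m\rangle}=\emptyset$ otherwise.
   Context: Mass problems are subsets of $\omega^\omega$; $\mathcal{A}\le_{\mathcal{M}}\mathcal{B}$ iff a partial Turing functional maps $\mathcal{B}$ into $\mathcal{A}$; $\mathcal{M}$ is the Medvedev lattice (a Brouwer algebra with bottom the degree of $\omega^\omega$ and top the degree of $\emptyset$). $(\mathcal{A}_i)\le_{\mathcal{M}_\omega}(\mathcal{B}_i)$ iff a single partial Turing functional $\Phi$ has $\Phi(n^\frown\mathcal{B}_n)\subseteq\mathcal{A}_n$ for all $n$ ($n^\frown f$ is $f$ preceded by $n$); $\mathcal{M}_\omega$ is the Brouwer algebra of these degrees. The hyperdoctrine $\mathcal{P}_{\mathcal{M}}$: base category with objects $\{1\},\{1,2\},\dots$ and $\omega$ and all computable functions as morphisms (products $\omega\times\omega\cong\omega$ via a fixed computable pairing $\langle n,m\rangle$, and finite products of finite sets identified with finite sets via fixed computable bijections); $\{1,\dots,n\}\mapsto\mathcal{M}^n$, $\omega\mapsto\mathcal{M}_\omega$, $\alpha\mapsto\alpha^*$ with $(\alpha^*((\mathcal{A}_j)))_i=\mathcal{A}_{\alpha(i)}$. The equality element $=_X$ is the element of $\mathcal{P}_{\mathcal{M}}(X\times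 X)$ such that for all $A\in\mathcal{P}_{\mathcal{M}}(X\times X)$: $\Delta_X^*(A)\le 0$ iff $A\le{=_X}$, where $\Delta_X:X\to X\times X$ is the diagonal and $0$ is the bottom element of $\mathcal{P}_{\mathcal{M}}(X)$. Equalities are up to equivalence of degrees. -}

module Defs where

open import Data.Nat using (ℕ; zero; suc; _+_; _<_)
open import Data.Fin using (Fin)
open import Data.Vec using (Vec; []; _∷_; lookup)
open import Data.Product using (Σ; _×_; _,_)
open import Data.Unit using (⊤)
open import Data.Empty using (⊥)
open import Data.Bool using (if_then_else_)
open import Relation.Nullary using (does; Dec)
open import Relation.Binary.PropositionalEquality using (_≡_)
import Data.Nat as N
import Data.Fin as F

Baire : Set
Baire = ℕ → ℕ

MassProblem : Set₁
MassProblem = Baire → Set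

ωω : MassProblem
ωω _ = ⊤

∅ : MassProblem
∅ _ = ⊥

_⁀_ : ℕ → Baire → Baire
(n ⁀ f) zero    = n
(n ⁀ f) (suc k) = f k

-- Oracle partial recursive functions (Kleene's μ-recursive functions
-- relative to an oracle); these are the partial Turing functionals.

data PR : ℕ → Set where
  zer    : ∀ {n} → PR n
  succ   : PR 1
  proj   : ∀ {n} → Fin n → PR n
  oracle : PR 1
  comp   : ∀ {m n} → PR m → Vec (PR n) m → PR n
  prec   : ∀ {n} → PR n → PR (suc (suc n)) → PR (suc n)
  mu     : ∀ {n} → PR (suc n) → PR n

mutual
  data Eval (f : Baire) : ∀ {n} → PR n → Vec ℕ n → ℕ → Set where
    e-zer    : ∀ {n} {xs : Vec ℕ n} → Eval f zer xs 0
    e-succ   : ∀ {x} → Eval f succ (x ∷ []) (suc x)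
    e-proj   : ∀ {n} {i : Fin n} {xs} → Eval f (proj i) xs (lookup xs i)
    e-oracle : ∀ {x} → Eval f oracle (x ∷ []) (f x)
    e-comp   : ∀ {m n} {g : PR m} {hs : Vec (PR n) m} {xs ys y}
             → EvalVec f hs xs ys → Eval f g ys y → Eval f (comp g hs) xs y
    e-prec0  : ∀ {n} {g : PR n} {h} {xs y}
             → Eval f g xs y → Eval f (prec g h) (0 ∷ xs) y
    e-precS  : ∀ {n} {g : PR n} {h} {k xs r y}
             → Eval f (prec g h) (k ∷ xs) r → Eval f h (k ∷ r ∷ xs) y
             → Eval f (prec g h) (suc k ∷ xs) y
    e-mu     : ∀ {n} {g : PR (suc n)} {xs y}
             → Eval f g (y ∷ xs) 0
             → (∀ z → z < y → Σ ℕ λ k → Eval f g (z ∷ xs) (suc k))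
             → Eval f (mu g) xs y

  data EvalVec (f : Baire) {n : ℕ} : ∀ {m} → Vec (PR n) m → Vec ℕ n → Vec ℕ m → Set where
    ev-[] : ∀ {xs} → EvalVec f [] xs []
    ev-∷  : ∀ {m} {h : PR n} {hs : Vec (PR n) m} {xs y ys}
          → Eval f h xs y → EvalVec f hs xs ys → EvalVec f (h ∷ hs) xs (y ∷ ys)

_⟨_⟩≡_ : PR 1 → Baire → Baire → Set
e ⟨ f ⟩≡ g = ∀ x → Eval f e (x ∷ []) (g x)

_≤M_ : MassProblem → MassProblem → Set
A ≤M B = Σ (PR 1) λ e → ∀ f → B f → Σ Baire λ g → (e ⟨ f ⟩≡ g) × A g

tri : ℕ → ℕ
tri zero    = zero
tri (suc k) = suc k + tri k

⟪_,_⟫ : ℕ → ℕ → ℕ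
⟪ n , m ⟫ = tri (n + m) + m

-- objects of the base category: fin k is {1,…,k+1}, omega is ω
data Obj : Set where
  fin   : ℕ → Obj
  omega : Obj

∣_∣ : Obj → Set
∣ fin k ∣ = Fin (suc k)
∣ omega ∣ = ℕ

decEq : (X : Obj) → (a b : ∣ X ∣) → Dec (a ≡ b)
decEq (fin k) a b = a F.≟ b
decEq omega   a b = a N.≟ b

-- elements of P_M(X) and of P_M(X × X) (X × X identified with the
-- corresponding finite set, resp. with ω via ⟨n,m⟩)
P : Obj → Set₁
P X = ∣ X ∣ → MassProblem

P² : Obj → Set₁
P² X = ∣ X ∣ × ∣ X ∣ → MassProblem

-- order of P_M(X): componentwise Medvedev order on M^k for X = {1,…,k},
-- the M_ω order (one uniform functional, input n ⁀ f) for X = ω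
Leq : (X : Obj) → P X → P X → Set
Leq (fin k) A B = ∀ i → A i ≤M B i
Leq omega   A B =
  Σ (PR 1) λ e → ∀ n f → B n f → Σ Baire λ g → (e ⟨ n ⁀ f ⟩≡ g) × A n g

-- order of P_M(X × X): X × X is again a finite set (componentwise order)
-- resp. ω, the index (n , m) corresponding to ⟨n,m⟩
Leq² : (X : Obj) → P² X → P² X → Set
Leq² (fin k) A B = ∀ p → A p ≤M B p
Leq² omega   A B =
  Σ (PR 1) λ e → ∀ n m f → B (n , m) f
    → Σ Baire λ g → (e ⟨ ⟪ n , m ⟫ ⁀ f ⟩≡ g) × A (n , m) g

𝟘 : (X : Obj) → P X
𝟘 X _ = ωω

Δ* : (X : Obj) → P² X → P X
Δ* X A i = A (i , i)

EqElt : (X : Obj) → P² X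
EqElt X (n , m) = if does (decEq X n m) then ωω else ∅

IsEquality : (X : Obj) → P² X → Set₁
IsEquality X E = ∀ (A : P² X) → (Leq X (Δ* X A) (𝟘 X) → Leq² X A E)
                                × (Leq² X A E → Leq X (Δ* X A) (𝟘 X))

module Submission where

open import Defs
open import Data.Nat using (ℕ; zero; suc; _+_; _∸_; _<_; _≤_; z≤n; s≤s; pred)
open import Data.Nat.Properties
  using (pred[m∸n]≡m∸[1+n]; n∸n≡0; +-∸-assoc; +-mono-≤; +-mono-≤-<; <⇒≤)
open import Data.Fin using (Fin) renaming (zero to fz; suc to fs)
open import Data.Vec using (Vec; []; _∷_; lookup; tabulate)
open import Data.Vec.Properties using (tabulate∘lookup)
open import Data.Product using (Σ; _×_; _,_)
open import Data.Unit using (⊤; tt)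
open import Data.Empty using (⊥-elim)
open import Relation.Nullary using (yes; no)
open import Relation.Binary.PropositionalEquality using (_≡_; refl; subst; sym)
import Data.Fin as F

-- Off the diagonal =_X is ∅, so only the diagonal components of A matter, and
-- there A ≤ =_X says exactly Δ*A ≤ 0. For X = ω the two sides of the
-- equivalence are witnessed by single functionals on the inputs n ⁀ f and
-- ⟪ n , n ⟫ ⁀ f respectively; a functional for one side becomes one for the
-- other by recomputing the head of the oracle (⟪ n , n ⟫ from n, or n from
-- ⟪ n , n ⟫ by a μ-search) and running the given functional relative to the
-- oracle with its head replaced.

tail : Baire → Baire
tail H k = H (suc k)

rename : ∀ {m n} → PR m → (Fin m → Fin n) → PR n
rename p ρ = comp p (tabulate (λ i → proj (ρ i)))

rename-eval : ∀ {H m n} {p : PR m} (ρ : Fin m → Fin n) {xs y} →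
  Eval H p (tabulate (λ i → lookup xs (ρ i))) y → Eval H (rename p ρ) xs y
rename-eval ρ = e-comp (projections ρ)
  where
  projections : ∀ {H n m} {xs : Vec ℕ n} (ρ : Fin m → Fin n) →
    EvalVec H (tabulate (λ i → proj (ρ i))) xs (tabulate (λ i → lookup xs (ρ i)))
  projections {m = zero}  ρ = ev-[]
  projections {m = suc m} ρ = ev-∷ e-proj (projections (λ i → ρ (fs i)))

swap₀₁ : ∀ {n} → Fin (suc (suc n)) → Fin (suc (suc n))
swap₀₁ fz          = fs fz
swap₀₁ (fs fz)     = fz
swap₀₁ (fs (fs i)) = fs (fs i)

rotate₃ : ∀ {n} → Fin (suc (suc (suc n))) → Fin (suc (suc (suc n)))
rotate₃ fz               = fs (fs fz)
rotate₃ (fs fz)          = fz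
rotate₃ (fs (fs fz))     = fs fz
rotate₃ (fs (fs (fs i))) = fs (fs (fs i))

swap₀₁-eval : ∀ {H n} {p : PR (suc (suc n))} {a b} {xs : Vec ℕ n} {y} →
  Eval H p (a ∷ b ∷ xs) y → Eval H (rename p swap₀₁) (b ∷ a ∷ xs) y
swap₀₁-eval {H} {p = p} {a} {b} {xs} {y} d =
  rename-eval swap₀₁ (subst (λ v → Eval H p (a ∷ b ∷ v) y) (sym (tabulate∘lookup xs)) d)

rotate₃-eval : ∀ {H n} {p : PR (suc (suc (suc n)))} {a b c} {xs : Vec ℕ n} {y} →
  Eval H p (a ∷ b ∷ c ∷ xs) y → Eval H (rename p rotate₃) (b ∷ c ∷ a ∷ xs) y
rotate₃-eval {H} {p = p} {a} {b} {c} {xs} {y} d =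
  rename-eval rotate₃ (subst (λ v → Eval H p (a ∷ b ∷ c ∷ v) y) (sym (tabulate∘lookup xs)) d)

oracleWithHead : PR 2
oracleWithHead = prec (proj fz) (comp oracle (comp succ (proj fz ∷ []) ∷ []))

oracleWithHead-eval : ∀ H c x → Eval H oracleWithHead (x ∷ c ∷ []) ((c ⁀ tail H) x)
oracleWithHead-eval H c zero    = e-prec0 e-proj
oracleWithHead-eval H c (suc k) =
  e-precS (oracleWithHead-eval H c k)
          (e-comp (ev-∷ (e-comp (ev-∷ e-proj ev-[]) e-succ) ev-[]) e-oracle)

mutual
  headAsArg : ∀ {n} → PR n → PR (suc n)
  headAsArg zer         = zer
  headAsArg succ        = comp succ (proj (fs fz) ∷ [])
  headAsArg (proj i)    = proj (fs i)
  headAsArg oracle      = comp oracleWithHead (proj (fs fz) ∷ proj fz ∷ [])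
  headAsArg (comp g hs) = comp (headAsArg g) (proj fz ∷ headAsArgs hs)
  headAsArg (prec g h)  = rename (headAsArgPrec g h) swap₀₁
  headAsArg (mu g)      = mu (rename (headAsArg g) swap₀₁)

  headAsArgs : ∀ {n m} → Vec (PR n) m → Vec (PR (suc n)) m
  headAsArgs []       = []
  headAsArgs (h ∷ hs) = headAsArg h ∷ headAsArgs hs

  -- takes the recursion variable first and the oracle head second
  headAsArgPrec : ∀ {n} → PR n → PR (suc (suc n)) → PR (suc (suc n))
  headAsArgPrec g h = prec (headAsArg g) (rename (headAsArg h) rotate₃)

mutual
  headAsArg-eval : ∀ {H c n} {p : PR n} {xs y} →
    Eval (c ⁀ tail H) p xs y → Eval H (headAsArg p) (c ∷ xs) y
  headAsArg-eval e-zer             = e-zer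
  headAsArg-eval e-succ            = e-comp (ev-∷ e-proj ev-[]) e-succ
  headAsArg-eval e-proj            = e-proj
  headAsArg-eval {H} {c} (e-oracle {x}) =
    e-comp (ev-∷ e-proj (ev-∷ e-proj ev-[])) (oracleWithHead-eval H c x)
  headAsArg-eval (e-comp ds d)     = e-comp (ev-∷ e-proj (headAsArgs-eval ds)) (headAsArg-eval d)
  headAsArg-eval d@(e-prec0 _)     = swap₀₁-eval (headAsArgPrec-eval d)
  headAsArg-eval d@(e-precS _ _)   = swap₀₁-eval (headAsArgPrec-eval d)
  headAsArg-eval (e-mu d₀ below)   =
    e-mu (swap₀₁-eval (headAsArg-eval d₀))
         (λ z z<y → let (k , dz) = below z z<y in k , swap₀₁-eval (headAsArg-eval dz))

  headAsArgs-eval : ∀ {H c n m} {hs : Vec (PR n) m} {xs ys} →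
    EvalVec (c ⁀ tail H) hs xs ys → EvalVec H (headAsArgs hs) (c ∷ xs) ys
  headAsArgs-eval ev-[]       = ev-[]
  headAsArgs-eval (ev-∷ d ds) = ev-∷ (headAsArg-eval d) (headAsArgs-eval ds)

  headAsArgPrec-eval : ∀ {H c n} {g : PR n} {h} {k xs y} →
    Eval (c ⁀ tail H) (prec g h) (k ∷ xs) y → Eval H (headAsArgPrec g h) (k ∷ c ∷ xs) y
  headAsArgPrec-eval (e-prec0 d)     = e-prec0 (headAsArg-eval d)
  headAsArgPrec-eval (e-precS dk dh) = e-precS (headAsArgPrec-eval dk) (rotate₃-eval (headAsArg-eval dh))

reheadWith : PR 1 → PR 1 → PR 1
reheadWith d e = comp (headAsArg e) (d ∷ proj fz ∷ [])

reheadWith-eval : ∀ {H c} {d e : PR 1} {g} →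
  (∀ x → Eval H d (x ∷ []) c) → e ⟨ c ⁀ tail H ⟩≡ g → reheadWith d e ⟨ H ⟩≡ g
reheadWith-eval d-eval e-eval x =
  e-comp (ev-∷ (d-eval x) (ev-∷ e-proj ev-[])) (headAsArg-eval (e-eval x))

addᴾ : PR 2
addᴾ = prec (proj fz) (comp succ (proj (fs fz) ∷ []))

addᴾ-eval : ∀ {H} x y → Eval H addᴾ (x ∷ y ∷ []) (x + y)
addᴾ-eval zero    y = e-prec0 e-proj
addᴾ-eval (suc x) y = e-precS (addᴾ-eval x y) (e-comp (ev-∷ e-proj ev-[]) e-succ)

predᴾ : PR 1
predᴾ = prec zer (proj fz)

predᴾ-eval : ∀ {H} x → Eval H predᴾ (x ∷ []) (pred x)
predᴾ-eval zero    = e-prec0 e-zer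
predᴾ-eval (suc x) = e-precS (predᴾ-eval x) e-proj

-- the subtrahend comes first, being the recursion variable
monusᴾ : PR 2
monusᴾ = prec (proj fz) (comp predᴾ (proj (fs fz) ∷ []))

monusᴾ-eval : ∀ {H} y x → Eval H monusᴾ (y ∷ x ∷ []) (x ∸ y)
monusᴾ-eval zero    x = e-prec0 e-proj
monusᴾ-eval {H} (suc y) x =
  subst (Eval H monusᴾ (suc y ∷ x ∷ [])) (pred[m∸n]≡m∸[1+n] x y)
        (e-precS (monusᴾ-eval y x) (e-comp (ev-∷ e-proj ev-[]) (predᴾ-eval (x ∸ y))))

triᴾ : PR 1
triᴾ = prec zer (comp addᴾ (comp succ (proj fz ∷ []) ∷ proj (fs fz) ∷ []))

triᴾ-eval : ∀ {H} k → Eval H triᴾ (k ∷ []) (tri k)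
triᴾ-eval zero    = e-prec0 e-zer
triᴾ-eval (suc k) =
  e-precS (triᴾ-eval k)
          (e-comp (ev-∷ (e-comp (ev-∷ e-proj ev-[]) e-succ) (ev-∷ e-proj ev-[]))
                  (addᴾ-eval (suc k) (tri k)))

diagPairᴾ : PR 1
diagPairᴾ = comp addᴾ (comp triᴾ (comp addᴾ (proj fz ∷ proj fz ∷ []) ∷ []) ∷ proj fz ∷ [])

diagPairᴾ-eval : ∀ {H} y → Eval H diagPairᴾ (y ∷ []) ⟪ y , y ⟫
diagPairᴾ-eval y =
  e-comp (ev-∷ (e-comp (ev-∷ (e-comp (ev-∷ e-proj (ev-∷ e-proj ev-[])) (addᴾ-eval y y)) ev-[])
                       (triᴾ-eval (y + y)))
               (ev-∷ e-proj ev-[]))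
         (addᴾ-eval (tri (y + y)) y)

tri-mono-≤ : ∀ {a b} → a ≤ b → tri a ≤ tri b
tri-mono-≤ z≤n     = z≤n
tri-mono-≤ (s≤s p) = +-mono-≤ (s≤s p) (tri-mono-≤ p)

diagPair-mono-< : ∀ {z n} → z < n → ⟪ z , z ⟫ < ⟪ n , n ⟫
diagPair-mono-< z<n = +-mono-≤-< (tri-mono-≤ (+-mono-≤ (<⇒≤ z<n) (<⇒≤ z<n))) z<n

readHeadᴾ : PR 1
readHeadᴾ = comp oracle (zer ∷ [])

readHeadᴾ-eval : ∀ {H} x → Eval H readHeadᴾ (x ∷ []) (H 0)
readHeadᴾ-eval x = e-comp (ev-∷ e-zer ev-[]) e-oracle

encodeHeadᴾ : PR 1
encodeHeadᴾ = comp diagPairᴾ (readHeadᴾ ∷ [])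

encodeHeadᴾ-eval : ∀ f n x → Eval (n ⁀ f) encodeHeadᴾ (x ∷ []) ⟪ n , n ⟫
encodeHeadᴾ-eval f n x = e-comp (ev-∷ (readHeadᴾ-eval x) ev-[]) (diagPairᴾ-eval n)

decodeStepᴾ : PR 2
decodeStepᴾ = comp monusᴾ (comp diagPairᴾ (proj fz ∷ []) ∷ comp readHeadᴾ (proj fz ∷ []) ∷ [])

decodeStepᴾ-eval : ∀ {H} y x → Eval H decodeStepᴾ (y ∷ x ∷ []) (H 0 ∸ ⟪ y , y ⟫)
decodeStepᴾ-eval y x =
  e-comp (ev-∷ (e-comp (ev-∷ e-proj ev-[]) (diagPairᴾ-eval y))
               (ev-∷ (e-comp (ev-∷ e-proj ev-[]) (readHeadᴾ-eval y)) ev-[]))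
         (monusᴾ-eval _ _)

-- the least y with ⟪ y , y ⟫ ≥ H 0
decodeHeadᴾ : PR 1
decodeHeadᴾ = mu decodeStepᴾ

decodeHeadᴾ-eval : ∀ f n x → Eval (⟪ n , n ⟫ ⁀ f) decodeHeadᴾ (x ∷ []) n
decodeHeadᴾ-eval f n x =
  e-mu (subst (Eval H decodeStepᴾ (n ∷ x ∷ [])) (n∸n≡0 ⟪ n , n ⟫) (decodeStepᴾ-eval n x))
       (λ z z<n → _ , subst (Eval H decodeStepᴾ (z ∷ x ∷ []))
                            (+-∸-assoc 1 (diagPair-mono-< z<n)) (decodeStepᴾ-eval z x))
  where
  H : Baire
  H = ⟪ n , n ⟫ ⁀ f

EqElt-diagonal : (X : Obj) (i : ∣ X ∣) (f : Baire) → EqElt X (i , i) f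
EqElt-diagonal X i f with decEq X i i
... | yes _  = tt
... | no i≢i = ⊥-elim (i≢i refl)

EqElt-≡ : (X : Obj) {a b : ∣ X ∣} {f : Baire} → EqElt X (a , b) f → a ≡ b
EqElt-≡ X {a} {b} p with decEq X a b
... | yes a≡b = a≡b

fin-Δ*≤𝟘⇒≤EqElt : ∀ k (A : P² (fin k)) →
  Leq (fin k) (Δ* (fin k) A) (𝟘 (fin k)) → Leq² (fin k) A (EqElt (fin k))
fin-Δ*≤𝟘⇒≤EqElt k A Δ*A≤𝟘 (a , b) with a F.≟ b
... | yes refl = Δ*A≤𝟘 a
... | no _     = zer , λ f ()

fin-≤EqElt⇒Δ*≤𝟘 : ∀ k (A : P² (fin k)) →
  Leq² (fin k) A (EqElt (fin k)) → Leq (fin k) (Δ* (fin k) A) (𝟘 (fin k))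
fin-≤EqElt⇒Δ*≤𝟘 k A A≤Eq i =
  let (e , reduces) = A≤Eq (i , i) in e , λ f _ → reduces f (EqElt-diagonal (fin k) i f)

ω-Δ*≤𝟘⇒≤EqElt : (A : P² omega) → Leq omega (Δ* omega A) (𝟘 omega) → Leq² omega A (EqElt omega)
ω-Δ*≤𝟘⇒≤EqElt A (e , reduces) = reheadWith decodeHeadᴾ e , reduces′
  where
  reduces′ : ∀ n m f → EqElt omega (n , m) f →
    Σ Baire λ g → (reheadWith decodeHeadᴾ e ⟨ ⟪ n , m ⟫ ⁀ f ⟩≡ g) × A (n , m) g
  reduces′ n m f p with EqElt-≡ omega {n} {m} {f} p
  reduces′ n .n f p | refl =
    let (g , e-eval , g∈A) = reduces n f tt
    in g , reheadWith-eval (decodeHeadᴾ-eval f n) e-eval , g∈A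

ω-≤EqElt⇒Δ*≤𝟘 : (A : P² omega) → Leq² omega A (EqElt omega) → Leq omega (Δ* omega A) (𝟘 omega)
ω-≤EqElt⇒Δ*≤𝟘 A (e , reduces) = reheadWith encodeHeadᴾ e , reduces′
  where
  reduces′ : ∀ n f → ⊤ → Σ Baire λ g → (reheadWith encodeHeadᴾ e ⟨ n ⁀ f ⟩≡ g) × A (n , n) g
  reduces′ n f _ =
    let (g , e-eval , g∈A) = reduces n n f (EqElt-diagonal omega n f)
    in g , reheadWith-eval (encodeHeadᴾ-eval f n) e-eval , g∈A

lemma4p10 : (X : Obj) → IsEquality X (EqElt X)
lemma4p10 (fin k) A = fin-Δ*≤𝟘⇒≤EqElt k A , fin-≤EqElt⇒Δ*≤𝟘 k A
lemma4p10 omega   A = ω-Δ*≤𝟘⇒≤EqElt A , ω-≤EqElt⇒Δ*≤𝟘 A
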